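{- Let $N$ be a positive integer that is not a perfect square, with continued fraction expansion $\sqrt N=[a_0;\overline{a_1,a_2,\ldots,a_{\tau-1},2a_0}]$ of (minimal) period length $\tau$, and let $\Omega_m=A_mA_{m-1}-NB_mB_{m-1}$ as in the context. Then the sequence $(\Omega_m)_{m\ge1}$ is periodic with period $\tau$ if $\tau$ is even and with period $2\tau$ if $\tau$ is odd. Moreover, $\Omega_{\tau-m-1}=(-1)^{\tau+1}\Omega_m$ for all $1\le m\le\tau-2$.
   Context: $a_0=\lfloor\sqrt N\rfloor$ and $(a_m)_{m\ge 0}$ are the partial quotients of $\sqrt N$. The convergents are defined by $A_{ -1}=1$, $B_{ -1}=0$, $A_0=a_0$, $B_0=1$, and for $m\ge1$: $A_m=a_mA_{m-1}+A_{m-2}$, $B_m=a_mB_{m-1}+B_{m-2}$. For $m\ge0$, $\Omega_m=A_mA_{m-1}-NB_mB_{m-1}$. -}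

module Defs where

open import Data.Nat as ℕ using (ℕ; zero; suc; _∸_; _≤ᵇ_)
open import Data.Nat.DivMod using (_/_)
open import Data.Bool using (if_then_else_)
open import Data.Integer as ℤ using (ℤ; +_; -_)
open import Data.Product using (_×_; _,_; proj₁; proj₂)

isqrtSearch : ℕ → ℕ → ℕ
isqrtSearch N zero = zero
isqrtSearch N (suc k) =
  if (suc k ℕ.* suc k) ≤ᵇ N then suc k else isqrtSearch N k

isqrt : ℕ → ℕ
isqrt N = isqrtSearch N N

a₀ : ℕ → ℕ
a₀ N = isqrt N

divℕ : ℕ → ℕ → ℕ
divℕ m zero = zero
divℕ m (suc n) = m / suc n

-- Complete quotients of √N: x_m = (P_m + √N) / Q_m, with
-- P_0 = 0, Q_0 = 1, a_m = ⌊x_m⌋ = ⌊(a₀ + P_m) / Q_m⌋,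
-- P_{m+1} = a_m Q_m - P_m, Q_{m+1} = (N - P_{m+1}^2) / Q_m.
PQstep : ℕ → ℕ × ℕ → ℕ × ℕ
PQstep N (P , Q) = step (divℕ (a₀ N ℕ.+ P) Q ℕ.* Q ∸ P)
  where
  step : ℕ → ℕ × ℕ
  step P' = (P' , divℕ (N ∸ P' ℕ.* P') Q)

PQ : ℕ → ℕ → ℕ × ℕ
PQ N zero = (0 , 1)
PQ N (suc m) = PQstep N (PQ N m)

pq : ℕ → ℕ → ℕ
pq N m = divℕ (a₀ N ℕ.+ proj₁ (PQ N m)) (proj₂ (PQ N m))

-- Shifted convergents: A' N k = A_{k-1}, B' N k = B_{k-1}
-- (so A' 0 = A_{-1} = 1, A' 1 = A_0 = a_0, ...).
A' : ℕ → ℕ → ℤ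
A' N zero = + 1
A' N (suc zero) = + a₀ N
A' N (suc (suc k)) = + pq N (suc k) ℤ.* A' N (suc k) ℤ.+ A' N k

B' : ℕ → ℕ → ℤ
B' N zero = + 0
B' N (suc zero) = + 1
B' N (suc (suc k)) = + pq N (suc k) ℤ.* B' N (suc k) ℤ.+ B' N k

A : ℕ → ℕ → ℤ
A N m = A' N (suc m)

B : ℕ → ℕ → ℤ
B N m = B' N (suc m)

Ω : ℕ → ℕ → ℤ
Ω N m = A' N (suc m) ℤ.* A' N m ℤ.- (+ N) ℤ.* B' N (suc m) ℤ.* B' N m

negOnePow : ℕ → ℤ
negOnePow zero = + 1
negOnePow (suc n) = - negOnePow n

IsPeriod : ℕ → ℕ → Set
IsPeriod N p = ∀ m → 1 ℕ.≤ m → pq N (m ℕ.+ p) Relation.Binary.PropositionalEquality.≡ pq N m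
  where import Relation.Binary.PropositionalEquality

IsMinimalPeriod : ℕ → ℕ → Set
IsMinimalPeriod N τ =
  1 ℕ.≤ τ × IsPeriod N τ × (∀ t → 1 ℕ.≤ t → IsPeriod N t → τ ℕ.≤ t)

{-# OPTIONS --safe #-}
-- Write the complete quotients of √N as (P_k + √N) / Q_k.  Induction on the recurrences of
-- the convergents gives Ω_k = (−1)ᵏ P_{k+1}, so everything is a statement about (P_k, Q_k).
-- From k = 1 on these pairs are reduced, and one step of the expansion is the composite of
-- two involutions of the finite set of reduced pairs, P ↦ ⌊(a₀ + P) / Q⌋ Q − P and
-- (P, Q) ↦ (P, (N − P²) / Q).  So the step is injective and is inverted by conjugating it with
-- the second involution.  By pigeonhole the expansion returns to (a₀, 1), and minimality of τ
-- makes τ the first return; hence P_{k+τ} = P_k for k ≥ 1, so Ω_{m+τ} = (−1)^τ Ω_m, which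
-- gives both periodicity claims.  Conjugation gives P_{m+1} = P_{τ−m}, the symmetry.
module Submission where

open import Defs
open import Data.Product using (∃; _×_; _,_; proj₁; proj₂)
open import Data.List using (_∷_; [])
open import Function using (_∘_)
open import Relation.Binary.PropositionalEquality
  using (_≡_; refl; sym; trans; cong; cong₂; subst; module ≡-Reasoning)

module SignIdentities where

  open import Data.Nat as ℕ using (zero; suc; _%_)
  import Data.Nat.Tactic.RingSolver as ℕ-Solver
  open import Data.Integer using (+_; -_; _+_; _-_; _*_; NonZero)
  open import Data.Integer.Properties
    using (*-identityˡ; *-identityʳ; *-cancelʳ-≡; neg-involutive; neg-distribˡ-*; pos-+; pos-*)
  open import Data.Integer.Tactic.RingSolver using (solve; solve-∀)
  open ≡-Reasoning

  negOnePow-+ : ∀ m n → negOnePow (m ℕ.+ n) ≡ negOnePow m * negOnePow n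
  negOnePow-+ zero    n = sym (*-identityˡ (negOnePow n))
  negOnePow-+ (suc m) n =
    trans (cong -_ (negOnePow-+ m n)) (neg-distribˡ-* (negOnePow m) (negOnePow n))

  negOnePow-*2 : ∀ n → negOnePow (n ℕ.* 2) ≡ + 1
  negOnePow-*2 zero    = refl
  negOnePow-*2 (suc n) = trans (neg-involutive _) (negOnePow-*2 n)

  negOnePow-even : ∀ n → n % 2 ≡ 0 → negOnePow n ≡ + 1
  negOnePow-even zero          _    = refl
  negOnePow-even (suc (suc n)) even = trans (neg-involutive _) (negOnePow-even n even)

  negOnePow-involutive : ∀ n x → negOnePow n * (negOnePow n * x) ≡ x
  negOnePow-involutive zero    x = solve (x ∷ [])
  negOnePow-involutive (suc n) x =
    trans (neg-neg (negOnePow n) x) (negOnePow-involutive n x)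
    where
    neg-neg : ∀ s x → - s * (- s * x) ≡ s * (s * x)
    neg-neg = solve-∀

  negOnePow-complement : ∀ {m j n} → m ℕ.+ suc j ≡ n →
    negOnePow j ≡ negOnePow (n ℕ.+ 1) * negOnePow m
  negOnePow-complement {m} {j} refl = sym (begin
    negOnePow (m ℕ.+ suc j ℕ.+ 1) * negOnePow m ≡⟨ sym (negOnePow-+ (m ℕ.+ suc j ℕ.+ 1) m) ⟩
    negOnePow (m ℕ.+ suc j ℕ.+ 1 ℕ.+ m)          ≡⟨ cong negOnePow (shuffle m j) ⟩
    negOnePow (j ℕ.+ suc m ℕ.* 2)                ≡⟨ negOnePow-+ j (suc m ℕ.* 2) ⟩
    negOnePow j * negOnePow (suc m ℕ.* 2)        ≡⟨ cong (negOnePow j *_) (negOnePow-*2 (suc m)) ⟩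
    negOnePow j * + 1                            ≡⟨ *-identityʳ (negOnePow j) ⟩
    negOnePow j                                  ∎)
    where
    shuffle : ∀ m j → m ℕ.+ suc j ℕ.+ 1 ℕ.+ m ≡ j ℕ.+ suc m ℕ.* 2
    shuffle = ℕ-Solver.solve-∀

  pos-difference : ∀ {x y a b} → x ℕ.+ y ≡ a ℕ.* b → + x ≡ + a * + b - + y
  pos-difference {x} {y} {a} {b} x+y≡ab = begin
    + x                 ≡⟨ add-sub (+ x) (+ y) ⟩
    + x + + y - + y     ≡⟨ cong (_- + y) (pos-+ x y) ⟨
    + (x ℕ.+ y) - + y   ≡⟨ cong (λ z → + z - + y) x+y≡ab ⟩
    + (a ℕ.* b) - + y   ≡⟨ cong (_- + y) (pos-* a b) ⟩
    + a * + b - + y     ∎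
    where
    add-sub : ∀ u v → u ≡ u + v - v
    add-sub = solve-∀

  pos-factorisation : ∀ {q q′ p n} → q ℕ.* q′ ℕ.+ p ℕ.* p ≡ n → + q * + q′ + + p * + p ≡ + n
  pos-factorisation {q} {q′} {p} refl =
    trans (cong₂ _+_ (sym (pos-* q q′)) (sym (pos-* p p))) (sym (pos-+ (q ℕ.* q′) (p ℕ.* p)))

  -- Ω₀ and the norms at k = 0, 1, with A₋₁ = 1, B₋₁ = 0, A₀ = a₀ and B₀ = 1.
  convergent-base : ∀ {a₀ n P₁ Q₁} → P₁ ≡ a₀ → Q₁ * + 1 + P₁ * P₁ ≡ n →
    (a₀ * + 1 - n * + 1 * + 0 ≡ + 1 * P₁)
    × (+ 1 * + 1 - n * + 0 * + 0 ≡ + 1 * + 1)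
    × (a₀ * a₀ - n * + 1 * + 1 ≡ - + 1 * Q₁)
  convergent-base {a₀} {n} {Q₁ = Q₁} refl fact =
    solve (a₀ ∷ n ∷ []) , solve (n ∷ []) , (begin
      a₀ * a₀ - n * + 1 * + 1                     ≡⟨ cong (λ m → a₀ * a₀ - m * + 1 * + 1) fact ⟨
      a₀ * a₀ - (Q₁ * + 1 + a₀ * a₀) * + 1 * + 1  ≡⟨ solve (a₀ ∷ Q₁ ∷ []) ⟩
      - + 1 * Q₁                                  ∎)

  -- Q₂ Q₁ + P₂² = n = Q₁ Q₀ + P₁², expanded with P₂ = a Q₁ − P₁ and cancelled by Q₁.
  Q-recurrence : ∀ a P₁ P₂ Q₀ Q₁ Q₂ n .{{_ : NonZero Q₁}} → P₂ ≡ a * Q₁ - P₁ →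
    Q₁ * Q₀ + P₁ * P₁ ≡ n → Q₂ * Q₁ + P₂ * P₂ ≡ n →
    Q₂ ≡ Q₀ + a * P₁ + a * P₁ - a * a * Q₁
  Q-recurrence a P₁ _ Q₀ Q₁ Q₂ _ refl fact₁ fact₂ = *-cancelʳ-≡ Q₂ _ Q₁ (begin
    Q₂ * Q₁
      ≡⟨ solve (a ∷ P₁ ∷ Q₁ ∷ Q₂ ∷ []) ⟩
    Q₂ * Q₁ + (a * Q₁ - P₁) * (a * Q₁ - P₁) - (a * Q₁ - P₁) * (a * Q₁ - P₁)
      ≡⟨ cong (_- (a * Q₁ - P₁) * (a * Q₁ - P₁)) (trans fact₂ (sym fact₁)) ⟩
    Q₁ * Q₀ + P₁ * P₁ - (a * Q₁ - P₁) * (a * Q₁ - P₁)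
      ≡⟨ solve (a ∷ P₁ ∷ Q₀ ∷ Q₁ ∷ []) ⟩
    (Q₀ + a * P₁ + a * P₁ - a * a * Q₁) * Q₁ ∎)

  convergent-step : ∀ a X Y U V n s P₁ P₂ Q₀ Q₁ Q₂ →
    X * Y - n * U * V ≡ s * P₁ → Y * Y - n * V * V ≡ s * Q₀ → X * X - n * U * U ≡ - s * Q₁ →
    P₂ ≡ a * Q₁ - P₁ → Q₂ ≡ Q₀ + a * P₁ + a * P₁ - a * a * Q₁ →
    ((a * X + Y) * X - n * (a * U + V) * U ≡ - s * P₂)
    × ((a * X + Y) * (a * X + Y) - n * (a * U + V) * (a * U + V) ≡ - - s * Q₂)
  convergent-step a X Y U V n s P₁ _ Q₀ Q₁ _ ω norm₀ norm₁ refl refl =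
    ω-next , norm-next
    where
    ω-next = begin
      (a * X + Y) * X - n * (a * U + V) * U       ≡⟨ solve (a ∷ X ∷ Y ∷ U ∷ V ∷ n ∷ []) ⟩
      a * (X * X - n * U * U) + (X * Y - n * U * V) ≡⟨ cong₂ (λ u v → a * u + v) norm₁ ω ⟩
      a * (- s * Q₁) + s * P₁                     ≡⟨ solve (a ∷ s ∷ P₁ ∷ Q₁ ∷ []) ⟩
      - s * (a * Q₁ - P₁)                         ∎
    norm-next = begin
      (a * X + Y) * (a * X + Y) - n * (a * U + V) * (a * U + V)
        ≡⟨ solve (a ∷ X ∷ Y ∷ U ∷ V ∷ n ∷ []) ⟩
      a * a * (X * X - n * U * U) + a * (X * Y - n * U * V) + a * (X * Y - n * U * V)
        + (Y * Y - n * V * V)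
        ≡⟨ cong₃ norm₁ ω norm₀ ⟩
      a * a * (- s * Q₁) + a * (s * P₁) + a * (s * P₁) + s * Q₀
        ≡⟨ solve (a ∷ s ∷ P₁ ∷ Q₀ ∷ Q₁ ∷ []) ⟩
      - - s * (Q₀ + a * P₁ + a * P₁ - a * a * Q₁) ∎
      where
      cong₃ : ∀ {u u′ v v′ w w′} → u ≡ u′ → v ≡ v′ → w ≡ w′ →
        a * a * u + a * v + a * v + w ≡ a * a * u′ + a * v′ + a * v′ + w′
      cong₃ refl refl refl = refl

open SignIdentities
open import Data.Empty using (⊥-elim)
open import Data.Bool using (true; false; T)
open import Data.Nat
  using (ℕ; zero; suc; _+_; _*_; _∸_; _≤_; _<_; _%_; _≤ᵇ_; z≤n; s≤s; z<s; >-nonZero; _≤?_)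
open import Data.Nat.Properties
open import Data.Nat.DivMod
  using (_/_; n/1≡n; m/n*n≤m; m≡m%n+[m/n]*n; m%n<n; m*n/n≡m; m<n⇒m/n≡0; +-distrib-/-∣ʳ; m≥n⇒m/n>0)
open import Data.Nat.Divisibility
  using (_∣_; divides; divides-refl; ∣m+n∣m⇒∣n; quotient; m∣n⇒n≡quotient*m)
open import Data.Nat.Tactic.RingSolver using (solve; solve-∀)
open import Data.Integer using (ℤ) renaming (_*_ to _*ℤ_)
open import Relation.Nullary using (¬_; yes; no)

isqrtSearch-sq≤ : ∀ N k → isqrtSearch N k * isqrtSearch N k ≤ N
isqrtSearch-sq≤ N zero = z≤n
isqrtSearch-sq≤ N (suc k) with suc k * suc k ≤ᵇ N in found
... | true  = ≤ᵇ⇒≤ (suc k * suc k) N (subst T (sym found) _)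
... | false = isqrtSearch-sq≤ N k

isqrtSearch-suc-sq> : ∀ N k → N < suc k * suc k →
  N < suc (isqrtSearch N k) * suc (isqrtSearch N k)
isqrtSearch-suc-sq> N zero    N<1 = N<1
isqrtSearch-suc-sq> N (suc k) N<[2+k]² with suc k * suc k ≤ᵇ N in found
... | true  = N<[2+k]²
... | false = isqrtSearch-suc-sq> N k (≰⇒> λ le → subst T found (≤⇒≤ᵇ le))

a₀-sq≤ : ∀ N → a₀ N * a₀ N ≤ N
a₀-sq≤ N = isqrtSearch-sq≤ N N

a₀-suc-sq> : ∀ N → N < suc (a₀ N) * suc (a₀ N)
a₀-suc-sq> N = isqrtSearch-suc-sq> N N (s≤s (m≤m+n N (N * suc N)))

-- The inequalities of a reduced quadratic irrational (P + √N) / Q, for r = ⌊√N⌋.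
record ReducedBounds (r P Q : ℕ) : Set where
  field
    P≤r   : P ≤ r
    r<P+Q : r < P + Q
    Q≤r+P : Q ≤ r + P

  Q>0 : 0 < Q
  Q>0 = +-cancelˡ-< P 0 Q (≤-<-trans (≤-reflexive (+-identityʳ P)) (≤-<-trans P≤r r<P+Q))

-- (r − P)(r + P) + P² = r², and the left-hand side grows with both factors.
sq-upper : ∀ {X Y P r} → P + X ≤ r → Y ≤ r + P → X * Y + P * P ≤ r * r
sq-upper {X} {Y} {P} {r} P+X≤r Y≤r+P = +-cancelʳ-≤ (P * r) _ _ (begin
  X * Y + P * P + P * r        ≤⟨ +-monoˡ-≤ (P * r) (+-monoˡ-≤ (P * P) (*-monoʳ-≤ X Y≤r+P)) ⟩
  X * (r + P) + P * P + P * r  ≡⟨ solve (X ∷ P ∷ r ∷ []) ⟩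
  (P + X) * (r + P)            ≤⟨ *-monoˡ-≤ (r + P) P+X≤r ⟩
  r * (r + P)                  ≡⟨ solve (P ∷ r ∷ []) ⟩
  r * r + P * r                ∎)
  where open ≤-Reasoning

sq-lower : ∀ {X Y P R} → R + P ≤ X → R ≤ P + Y → R * R ≤ X * Y + P * P
sq-lower {X} {Y} {P} {R} R+P≤X R≤P+Y = +-cancelʳ-≤ (R * P) _ _ (begin
  R * R + R * P                ≡⟨ solve (P ∷ R ∷ []) ⟩
  (R + P) * R                  ≤⟨ *-monoʳ-≤ (R + P) R≤P+Y ⟩
  (R + P) * (P + Y)            ≡⟨ solve (Y ∷ P ∷ R ∷ []) ⟩
  (R + P) * Y + P * P + R * P  ≤⟨ +-monoˡ-≤ (R * P) (+-monoˡ-≤ (P * P) (*-monoˡ-≤ Y R+P≤X)) ⟩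
  X * Y + P * P + R * P        ∎)
  where open ≤-Reasoning

factorisation-bounds : ∀ {r N P Q c} → r * r < N → N < suc r * suc r →
  c * Q + P * P ≡ N → ReducedBounds r P Q → ReducedBounds r P c
factorisation-bounds {r} r²<N N<[1+r]² factorises b = record
  { P≤r   = P≤r
  ; r<P+Q = ≰⇒> λ P+c≤r → <⇒≱ r²<N (subst (_≤ r * r) factorises (sq-upper P+c≤r Q≤r+P))
  ; Q≤r+P = ≮⇒≥ λ r+P<c →
      <⇒≱ N<[1+r]² (subst (suc r * suc r ≤_) factorises (sq-lower r+P<c r<P+Q))
  }
  where open ReducedBounds b

divℕ-remainder : ∀ m {Q} → 0 < Q → ∃ λ k → k < Q × k + divℕ m Q * Q ≡ m
divℕ-remainder m {suc q} _ = m % suc q , m%n<n m (suc q) , sym (m≡m%n+[m/n]*n m (suc q))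

divℕ-unique : ∀ {k a Q} → k < Q → divℕ (k + a * Q) Q ≡ a
divℕ-unique {k} {a} {suc q} k<Q = begin
  (k + a * suc q) / suc q            ≡⟨ +-distrib-/-∣ʳ k (divides-refl a) ⟩
  k / suc q + a * suc q / suc q      ≡⟨ cong₂ _+_ (m<n⇒m/n≡0 k<Q) (m*n/n≡m a (suc q)) ⟩
  a                                  ∎
  where open ≡-Reasoning

divℕ-pos : ∀ {m Q} → 0 < Q → Q ≤ m → 0 < divℕ m Q
divℕ-pos {Q = suc q} _ Q≤m = m≥n⇒m/n>0 Q≤m

divℕ-*-≤ : ∀ m Q → divℕ m Q * Q ≤ m
divℕ-*-≤ m zero    = z≤n
divℕ-*-≤ m (suc q) = m/n*n≤m m (suc q)

divℕ-cofactor : ∀ {c Q M N} → 0 < Q → c * Q + M ≡ N → divℕ (N ∸ M) Q ≡ c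
divℕ-cofactor {c} {Q} {M} Q>0 refl =
  trans (cong (λ x → divℕ x Q) (m+n∸n≡m (c * Q) M)) (divℕ-unique {0} Q>0)

-- For reduced bounds, the representative of −P modulo Q in the window (r − Q, r].
reflect : ℕ → ℕ → ℕ → ℕ
reflect r Q P = divℕ (r + P) Q * Q ∸ P

module _ {r P Q : ℕ} (b : ReducedBounds r P Q) where

  open ReducedBounds b

  private
    a : ℕ
    a = divℕ (r + P) Q

    k : ℕ
    k = proj₁ (divℕ-remainder (r + P) Q>0)

    k<Q : k < Q
    k<Q = proj₁ (proj₂ (divℕ-remainder (r + P) Q>0))

    k+aQ≡r+P : k + a * Q ≡ r + P
    k+aQ≡r+P = proj₂ (proj₂ (divℕ-remainder (r + P) Q>0))

    Q≤aQ : Q ≤ a * Q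
    Q≤aQ = m≤n*m Q a {{>-nonZero (divℕ-pos Q>0 Q≤r+P)}}

    P≤aQ : P ≤ a * Q
    P≤aQ with Q ≤? r
    ... | yes Q≤r = +-cancelˡ-≤ r P (a * Q)
      (subst (_≤ r + a * Q) k+aQ≡r+P (+-monoˡ-≤ (a * Q) (<⇒≤ (<-≤-trans k<Q Q≤r))))
    ... | no  Q≰r = ≤-trans P≤r (≤-trans (<⇒≤ (≰⇒> Q≰r)) Q≤aQ)

  reflect-+ : reflect r Q P + P ≡ divℕ (r + P) Q * Q
  reflect-+ = m∸n+n≡m P≤aQ

  private
    P′ : ℕ
    P′ = reflect r Q P

    P′+k≡r : P′ + k ≡ r
    P′+k≡r = +-cancelʳ-≡ P _ _ (begin
      P′ + k + P  ≡⟨ swap P′ k P ⟩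
      P′ + P + k  ≡⟨ cong (_+ k) reflect-+ ⟩
      a * Q + k   ≡⟨ +-comm (a * Q) k ⟩
      k + a * Q   ≡⟨ k+aQ≡r+P ⟩
      r + P       ∎)
      where
      open ≡-Reasoning
      swap : ∀ x y z → x + y + z ≡ x + z + y
      swap = solve-∀

  reflect-bounds : ReducedBounds r (reflect r Q P) Q
  reflect-bounds = record
    { P≤r   = subst (P′ ≤_) P′+k≡r (m≤m+n P′ k)
    ; r<P+Q = subst (_< P′ + Q) P′+k≡r (+-monoʳ-< P′ k<Q)
    ; Q≤r+P = begin
        Q        ≤⟨ Q≤aQ ⟩
        a * Q    ≡⟨ reflect-+ ⟨
        P′ + P   ≤⟨ +-monoʳ-≤ P′ P≤r ⟩
        P′ + r   ≡⟨ +-comm P′ r ⟩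
        r + P′   ∎
    }
    where open ≤-Reasoning

  reflect-involutive : reflect r Q (reflect r Q P) ≡ P
  reflect-involutive = begin
    divℕ (r + P′) Q * Q ∸ P′          ≡⟨ cong (λ x → divℕ x Q * Q ∸ P′) r+P′≡[r∸P]+aQ ⟩
    divℕ (r ∸ P + a * Q) Q * Q ∸ P′   ≡⟨ cong (λ x → x * Q ∸ P′) (divℕ-unique {a = a} r∸P<Q) ⟩
    a * Q ∸ P′                        ≡⟨ cong (_∸ P′) reflect-+ ⟨
    P′ + P ∸ P′                       ≡⟨ m+n∸m≡n P′ P ⟩
    P                                 ∎
    where
    open ≡-Reasoning
    r∸P<Q : r ∸ P < Q
    r∸P<Q = m<n+o⇒m∸n<o r P {{>-nonZero Q>0}} r<P+Q
    r+P′≡[r∸P]+aQ : r + P′ ≡ r ∸ P + a * Q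
    r+P′≡[r∸P]+aQ = begin
      r + P′           ≡⟨ cong (_+ P′) (m∸n+n≡m P≤r) ⟨
      r ∸ P + P + P′   ≡⟨ +-assoc (r ∸ P) P P′ ⟩
      r ∸ P + (P + P′) ≡⟨ cong (r ∸ P +_) (trans (+-comm P P′) reflect-+) ⟩
      r ∸ P + a * Q    ∎

reflect-by-1 : ∀ r P → reflect r 1 P ≡ r
reflect-by-1 r P = trans (cong (_∸ P) (trans (*-identityʳ _) (n/1≡n (r + P)))) (m+n∸n≡m r P)

-- N − P′² = cQ + (P − P′)(P′ + P), and P′ + P = aQ.
cofactor-reflect : ∀ {N c Q P P′ a} → c * Q + P * P ≡ N → P′ + P ≡ a * Q → P′ * P′ ≤ N →
  ∃ λ c′ → c′ * Q + P′ * P′ ≡ N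
cofactor-reflect {N} {c} {Q} {P} {P′} {a} factorises P′+P≡aQ P′²≤N =
  quotient Q∣N∸P′² ,
  trans (cong (_+ P′ * P′) (sym (m∣n⇒n≡quotient*m Q∣N∸P′²))) (m∸n+n≡m P′²≤N)
  where
  open ≡-Reasoning
  Q∣ : ∀ M → M + P′ * P′ ≡ N → Q ∣ M
  Q∣ M M+P′²≡N = ∣m+n∣m⇒∣n
    (divides (c + P * a) (begin
      P′ * (a * Q) + M          ≡⟨ cong (λ x → P′ * x + M) P′+P≡aQ ⟨
      P′ * (P′ + P) + M         ≡⟨ solve (P′ ∷ P ∷ M ∷ []) ⟩
      P′ * P + (M + P′ * P′)    ≡⟨ cong (P′ * P +_) (trans M+P′²≡N (sym factorises)) ⟩
      P′ * P + (c * Q + P * P)  ≡⟨ solve (P′ ∷ P ∷ c ∷ Q ∷ []) ⟩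
      c * Q + P * (P′ + P)      ≡⟨ cong (λ x → c * Q + P * x) P′+P≡aQ ⟩
      c * Q + P * (a * Q)       ≡⟨ solve (c ∷ P ∷ a ∷ Q ∷ []) ⟩
      (c + P * a) * Q           ∎))
    (divides (P′ * a) (solve (P′ ∷ a ∷ Q ∷ [])))
  Q∣N∸P′² : Q ∣ N ∸ P′ * P′
  Q∣N∸P′² = Q∣ (N ∸ P′ * P′) (m∸n+n≡m P′²≤N)

squeezed-root>0 : ∀ {r N} → r * r < N → N < suc r * suc r → 0 < r
squeezed-root>0 {zero}  (s≤s z≤n) (s≤s ())
squeezed-root>0 {suc r} _         _        = z<s

<-of-≤∸2 : ∀ {m n} → 0 < m → m ≤ n ∸ 2 → m < n
<-of-≤∸2 {suc _} {zero}        _ ()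
<-of-≤∸2 {suc _} {suc zero}    _ ()
<-of-≤∸2 {suc _} {suc (suc n)} _ m≤n = s≤s (m≤n⇒m≤1+n m≤n)

m+suc[n∸m∸1]≡n : ∀ {m n} → m < n → m + suc (n ∸ m ∸ 1) ≡ n
m+suc[n∸m∸1]≡n {zero}  {suc n} _         = refl
m+suc[n∸m∸1]≡n {suc m} {suc n} (s≤s m<n) = cong suc (m+suc[n∸m∸1]≡n m<n)

module CompleteQuotients (N : ℕ) (a₀²<N : a₀ N * a₀ N < N) where

  open import Data.Fin as Fin using (Fin; toℕ; fromℕ<; combine)
  open import Data.Fin.Properties using (pigeonhole; combine-injective; fromℕ<-injective)
  open import Data.Integer using (+_) renaming (_+_ to _+ℤ_; _-_ to _-ℤ_)
  import Data.Integer.Properties as ℤ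
  open import Data.Nat.Induction using (<-rec)

  r : ℕ
  r = a₀ N

  N<[1+r]² : N < suc r * suc r
  N<[1+r]² = a₀-suc-sq> N

  record Reduced (s : ℕ × ℕ) : Set where
    field
      bounds     : ReducedBounds r (proj₁ s) (proj₂ s)
      cofactor   : ℕ
      factorises : cofactor * proj₂ s + proj₁ s * proj₁ s ≡ N

    open ReducedBounds bounds public

  open Reduced

  sq≤N : ∀ {P} → P ≤ r → P * P ≤ N
  sq≤N P≤r = ≤-trans (*-mono-≤ P≤r P≤r) (<⇒≤ a₀²<N)

  -- PQstep N is, definitionally, reverse ∘ divide; both are involutions on reduced pairs.
  divide : ℕ × ℕ → ℕ × ℕ
  divide (P , Q) = (reflect r Q P , Q)

  reverse : ℕ × ℕ → ℕ × ℕ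
  reverse (P , Q) = (P , divℕ (N ∸ P * P) Q)

  partial-quotient : ℕ × ℕ → ℕ
  partial-quotient (P , Q) = divℕ (r + P) Q

  reverse-cofactor : ∀ {P Q} (red : Reduced (P , Q)) → reverse (P , Q) ≡ (P , cofactor red)
  reverse-cofactor {P} red = cong (P ,_) (divℕ-cofactor (Q>0 red) (factorises red))

  cofactor-reduced : ∀ {P Q} (red : Reduced (P , Q)) → Reduced (P , cofactor red)
  cofactor-reduced {P} {Q} red = record
    { bounds     = factorisation-bounds a₀²<N N<[1+r]² (factorises red) (bounds red)
    ; cofactor   = Q
    ; factorises = trans (cong (_+ P * P) (*-comm Q (cofactor red))) (factorises red)
    }

  reverse-reduced : ∀ {s} → Reduced s → Reduced (reverse s)
  reverse-reduced red = subst Reduced (sym (reverse-cofactor red)) (cofactor-reduced red)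

  reverse-involutive : ∀ {s} → Reduced s → reverse (reverse s) ≡ s
  reverse-involutive red =
    trans (cong reverse (reverse-cofactor red)) (reverse-cofactor (cofactor-reduced red))

  reverse-factorises : ∀ {P Q} → Reduced (P , Q) → proj₂ (reverse (P , Q)) * Q + P * P ≡ N
  reverse-factorises red =
    subst (λ c → c * _ + _ ≡ N) (sym (cong proj₂ (reverse-cofactor red))) (factorises red)

  divide-reduced : ∀ {s} → Reduced s → Reduced (divide s)
  divide-reduced {P , Q} red = record
    { bounds     = reflected
    ; cofactor   = proj₁ next
    ; factorises = proj₂ next
    }
    where
    reflected : ReducedBounds r (reflect r Q P) Q
    reflected = reflect-bounds (bounds red)
    next : ∃ λ c → c * Q + reflect r Q P * reflect r Q P ≡ N
    next = cofactor-reflect {c = cofactor red} {P′ = reflect r Q P} {a = divℕ (r + P) Q}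
             (factorises red) (reflect-+ (bounds red))
             (sq≤N (ReducedBounds.P≤r reflected))

  divide-involutive : ∀ {s} → Reduced s → divide (divide s) ≡ s
  divide-involutive red = cong (_, _) (reflect-involutive (bounds red))

  divide-by-1 : ∀ P → divide (P , 1) ≡ (r , 1)
  divide-by-1 P = cong (_, 1) (reflect-by-1 r P)

  step-injective : ∀ {s t} → Reduced s → Reduced t → PQstep N s ≡ PQstep N t → s ≡ t
  step-injective {s} {t} red-s red-t same = begin
    s                              ≡⟨ divide-involutive red-s ⟨
    divide (divide s)              ≡⟨ cong divide (reverse-involutive (divide-reduced red-s)) ⟨
    divide (reverse (PQstep N s))  ≡⟨ cong (divide ∘ reverse) same ⟩
    divide (reverse (PQstep N t))  ≡⟨ cong divide (reverse-involutive (divide-reduced red-t)) ⟩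
    divide (divide t)              ≡⟨ divide-involutive red-t ⟩
    t                              ∎
    where open ≡-Reasoning

  step-reverse : ∀ {s} → Reduced s → PQstep N (reverse (PQstep N s)) ≡ reverse s
  step-reverse red = trans (cong (reverse ∘ divide) (reverse-involutive (divide-reduced red)))
                           (cong reverse (divide-involutive red))

  step-by-1 : ∀ P → PQstep N (P , 1) ≡ PQ N 1
  step-by-1 P = cong reverse (trans (divide-by-1 P) (sym (divide-by-1 0)))

  reduced-r,1 : Reduced (r , 1)
  reduced-r,1 = record
    { bounds     = record
      { P≤r   = ≤-refl
      ; r<P+Q = m<m+n r z<s
      ; Q≤r+P = ≤-trans (squeezed-root>0 a₀²<N N<[1+r]²) (m≤m+n r r)
      }
    ; cofactor   = N ∸ r * r
    ; factorises = trans (cong (_+ r * r) (*-identityʳ (N ∸ r * r))) (m∸n+n≡m (<⇒≤ a₀²<N))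
    }

  partial-quotient-2r : ∀ {s} → Reduced s → partial-quotient s ≡ r + r → s ≡ (r , 1)
  partial-quotient-2r {P , zero} red _ = ⊥-elim (<⇒≱ (Q>0 red) z≤n)
  partial-quotient-2r {P , suc zero} red a≡2r =
    cong (_, 1) (+-cancelˡ-≡ r P r (trans (sym (n/1≡n (r + P))) a≡2r))
  partial-quotient-2r {P , Q@(suc (suc _))} red a≡2r =
    ⊥-elim (<⇒≱ (m<m*n (r + r) Q {{>-nonZero 2r>0}} (s≤s (s≤s z≤n))) (begin
      (r + r) * Q                ≡⟨ cong (_* Q) a≡2r ⟨
      divℕ (r + P) Q * Q         ≤⟨ divℕ-*-≤ (r + P) Q ⟩
      r + P                      ≤⟨ +-monoʳ-≤ r (P≤r red) ⟩
      r + r                      ∎))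
    where
    open ≤-Reasoning
    2r>0 : 0 < r + r
    2r>0 = ≤-trans (Q>0 red) (≤-trans (Q≤r+P red) (+-monoʳ-≤ r (P≤r red)))

  P[_] : ℕ → ℕ
  P[ k ] = proj₁ (PQ N k)

  Q[_] : ℕ → ℕ
  Q[ k ] = proj₂ (PQ N k)

  reduced-divided : ∀ k → Reduced (divide (PQ N k))
  reduced-divided zero    = subst Reduced (sym (divide-by-1 0)) reduced-r,1
  reduced-divided (suc k) = divide-reduced (reverse-reduced (reduced-divided k))

  reduced-PQ : ∀ k → Reduced (PQ N (suc k))
  reduced-PQ k = reverse-reduced (reduced-divided k)

  P-recurrence : ∀ k → P[ suc k ] + P[ k ] ≡ pq N k * Q[ k ]
  P-recurrence zero    = +-identityʳ _
  P-recurrence (suc k) = reflect-+ (bounds (reduced-PQ k))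

  Q-factorisation : ∀ k → Q[ suc k ] * Q[ k ] + P[ suc k ] * P[ suc k ] ≡ N
  Q-factorisation k = reverse-factorises (reduced-divided k)

  Q>0-PQ : ∀ k → 0 < Q[ k ]
  Q>0-PQ zero    = z<s
  Q>0-PQ (suc k) = Q>0 (reduced-PQ k)

  return-shift : ∀ {T} → PQ N T ≡ (r , 1) → ∀ m → PQ N (suc m + T) ≡ PQ N (suc m)
  return-shift returned zero    = trans (cong (PQstep N) returned) (step-by-1 r)
  return-shift returned (suc m) = cong (PQstep N) (return-shift returned m)

  return-period : ∀ {T} → PQ N T ≡ (r , 1) → IsPeriod N T
  return-period returned (suc m) _ = cong partial-quotient (return-shift returned m)

  repetition-from-start : ∀ i d → PQ N (suc i) ≡ PQ N (suc i + d) → PQ N 1 ≡ PQ N (suc d)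
  repetition-from-start zero    d same = same
  repetition-from-start (suc i) d same =
    repetition-from-start i d (step-injective (reduced-PQ i) (reduced-PQ (i + d)) same)

  -- Reduced pairs satisfy P ≤ r and Q ≤ 2r, so K + 1 of them must contain a repetition.
  private
    K : ℕ
    K = suc r * suc (r + r)

    P<1+r : ∀ k → P[ suc k ] < suc r
    P<1+r k = s≤s (P≤r (reduced-PQ k))

    Q<1+2r : ∀ k → Q[ suc k ] < suc (r + r)
    Q<1+2r k = s≤s (≤-trans (Q≤r+P (reduced-PQ k)) (+-monoʳ-≤ r (P≤r (reduced-PQ k))))

    code : Fin (suc K) → Fin K
    code i = combine (fromℕ< (P<1+r (toℕ i))) (fromℕ< (Q<1+2r (toℕ i)))

    code-injective : ∀ i j → code i ≡ code j → PQ N (suc (toℕ i)) ≡ PQ N (suc (toℕ j))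
    code-injective i j same-code with combine-injective _ _ _ _ same-code
    ... | same-P , same-Q =
      cong₂ _,_ (fromℕ<-injective _ _ _ _ same-P) (fromℕ<-injective _ _ _ _ same-Q)

  return-exists : ∃ λ d → PQ N (suc d) ≡ (r , 1)
  return-exists = collision (pigeonhole (n<1+n K) code)
    where
    collision : (∃ λ i → ∃ λ j → i Fin.< j × code i ≡ code j) →
      ∃ λ d → PQ N (suc d) ≡ (r , 1)
    collision (i , j , i<j , same-code) = d , step-injective (reduced-PQ d) reduced-r,1 (begin
      PQ N (suc (suc d))   ≡⟨ repetition-from-start (toℕ i) (suc d) repeated ⟨
      PQ N 1               ≡⟨ step-by-1 r ⟨
      PQstep N (r , 1)     ∎)
      where
      open ≡-Reasoning
      d : ℕ
      d = proj₁ (m≤n⇒∃[o]m+o≡n i<j)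
      repeated : PQ N (suc (toℕ i)) ≡ PQ N (suc (toℕ i) + suc d)
      repeated = trans (code-injective i j same-code) (cong (λ n → PQ N (suc n))
        (trans (sym (proj₂ (m≤n⇒∃[o]m+o≡n i<j))) (sym (+-suc (toℕ i) d))))

  P-recurrenceℤ : ∀ k → + P[ suc (suc k) ] ≡ + pq N (suc k) *ℤ + Q[ suc k ] -ℤ + P[ suc k ]
  P-recurrenceℤ k = pos-difference {a = pq N (suc k)} {b = Q[ suc k ]} (P-recurrence (suc k))

  Q-factorisationℤ : ∀ k → + Q[ suc k ] *ℤ + Q[ k ] +ℤ + P[ suc k ] *ℤ + P[ suc k ] ≡ + N
  Q-factorisationℤ k =
    pos-factorisation {q = Q[ suc k ]} {q′ = Q[ k ]} {p = P[ suc k ]} (Q-factorisation k)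

  private
    norm : ℕ → ℤ
    norm j = A' N j *ℤ A' N j -ℤ + N *ℤ B' N j *ℤ B' N j

    -- Together with Ω_k = (−1)ᵏ P_{k+1}, the norms A_{k−1}² − N B_{k−1}² = (−1)ᵏ Q_k
    -- at k and k + 1 carry the induction.
    Invariant : ℕ → Set
    Invariant k = (Ω N k ≡ negOnePow k *ℤ + P[ suc k ])
                × (norm k ≡ negOnePow k *ℤ + Q[ k ])
                × (norm (suc k) ≡ negOnePow (suc k) *ℤ + Q[ suc k ])

    invariant : ∀ k → Invariant k
    invariant zero =
      convergent-base (cong +_ (reflect-by-1 r 0)) (Q-factorisationℤ 0)
    invariant (suc k) with invariant k
    ... | ω , norm₀ , norm₁ = proj₁ next , norm₁ , proj₂ next
      where
      a = + pq N (suc k)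
      P₁ = + P[ suc k ]
      P₂ = + P[ suc (suc k) ]
      Q₀ = + Q[ k ]
      Q₁ = + Q[ suc k ]
      Q₂ = + Q[ suc (suc k) ]
      Q-next = Q-recurrence a P₁ P₂ Q₀ Q₁ Q₂ (+ N) {{>-nonZero (Q>0-PQ (suc k))}}
                 (P-recurrenceℤ k) (Q-factorisationℤ k) (Q-factorisationℤ (suc k))
      next = convergent-step a (A' N (suc k)) (A' N k) (B' N (suc k)) (B' N k) (+ N)
               (negOnePow k) P₁ P₂ Q₀ Q₁ Q₂ ω norm₀ norm₁ (P-recurrenceℤ k) Q-next

  Ω-formula : ∀ k → Ω N k ≡ negOnePow k *ℤ + P[ suc k ]
  Ω-formula k = proj₁ (invariant k)

  module Period (τ : ℕ) (τ-minimal : IsMinimalPeriod N τ) where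

    private
      τ-period : IsPeriod N τ
      τ-period = proj₁ (proj₂ τ-minimal)

      τ-least : ∀ t → 1 ≤ t → IsPeriod N t → τ ≤ t
      τ-least = proj₂ (proj₂ τ-minimal)

    -- A return at τ + e with e > 0 gives a_e = a_{τ+e} = 2r, hence an earlier return at e.
    first-return : ∀ T → 0 < T → PQ N T ≡ (r , 1) → PQ N τ ≡ (r , 1)
    first-return = <-rec _ descend
      where
      descend : ∀ T → (∀ {T′} → T′ < T → 0 < T′ → PQ N T′ ≡ (r , 1) → PQ N τ ≡ (r , 1)) →
        0 < T → PQ N T ≡ (r , 1) → PQ N τ ≡ (r , 1)
      descend T earlier 0<T returned
        with m≤n⇒∃[o]m+o≡n (τ-least T 0<T (return-period returned))
      ... | zero  , refl = subst (λ t → PQ N t ≡ (r , 1)) (+-identityʳ τ) returned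
      ... | suc e , refl = earlier (m<n+m (suc e) (proj₁ τ-minimal)) z<s
        (partial-quotient-2r (reduced-PQ e) (begin
          pq N (suc e)       ≡⟨ τ-period (suc e) z<s ⟨
          pq N (suc e + τ)   ≡⟨ cong (pq N) (+-comm (suc e) τ) ⟩
          pq N (τ + suc e)   ≡⟨ cong partial-quotient returned ⟩
          divℕ (r + r) 1     ≡⟨ n/1≡n (r + r) ⟩
          r + r              ∎))
        where open ≡-Reasoning

    PQ-τ : PQ N τ ≡ (r , 1)
    PQ-τ = first-return (suc (proj₁ return-exists)) z<s (proj₂ return-exists)

    reverse-PQ : ∀ m j → m + suc j ≡ τ → reverse (PQ N (suc m)) ≡ PQ N (suc j)
    reverse-PQ zero j 1+j≡τ = begin
      reverse (PQ N 1)  ≡⟨ reverse-involutive (reduced-divided 0) ⟩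
      divide (0 , 1)    ≡⟨ divide-by-1 0 ⟩
      (r , 1)           ≡⟨ PQ-τ ⟨
      PQ N τ            ≡⟨ cong (PQ N) 1+j≡τ ⟨
      PQ N (suc j)      ∎
      where open ≡-Reasoning
    reverse-PQ (suc m) j m+2+j≡τ =
      step-injective (reverse-reduced (reduced-PQ (suc m))) (reduced-PQ j) (begin
        PQstep N (reverse (PQ N (suc (suc m))))  ≡⟨ step-reverse (reduced-PQ m) ⟩
        reverse (PQ N (suc m))
          ≡⟨ reverse-PQ m (suc j) (trans (+-suc m (suc j)) m+2+j≡τ) ⟩
          PQ N (suc (suc j))                       ∎)
      where open ≡-Reasoning

    Ω-shift : ∀ m → Ω N (m + τ) ≡ negOnePow τ *ℤ Ω N m
    Ω-shift m = begin
      Ω N (m + τ)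
        ≡⟨ Ω-formula (m + τ) ⟩
      negOnePow (m + τ) *ℤ + P[ suc m + τ ]
        ≡⟨ cong₂ (λ σ s → σ *ℤ + proj₁ s) (negOnePow-+ m τ) (return-shift PQ-τ m) ⟩
      negOnePow m *ℤ negOnePow τ *ℤ + P[ suc m ]
        ≡⟨ cong (_*ℤ + P[ suc m ]) (ℤ.*-comm (negOnePow m) (negOnePow τ)) ⟩
      negOnePow τ *ℤ negOnePow m *ℤ + P[ suc m ]
        ≡⟨ ℤ.*-assoc (negOnePow τ) (negOnePow m) (+ P[ suc m ]) ⟩
      negOnePow τ *ℤ (negOnePow m *ℤ + P[ suc m ])
        ≡⟨ cong (negOnePow τ *ℤ_) (Ω-formula m) ⟨
      negOnePow τ *ℤ Ω N m
        ∎
      where open ≡-Reasoning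

    Ω-even-shift : τ % 2 ≡ 0 → ∀ m → Ω N (m + τ) ≡ Ω N m
    Ω-even-shift even m = begin
      Ω N (m + τ)                 ≡⟨ Ω-shift m ⟩
      negOnePow τ *ℤ Ω N m        ≡⟨ cong (_*ℤ Ω N m) (negOnePow-even τ even) ⟩
      + 1 *ℤ Ω N m                ≡⟨ ℤ.*-identityˡ (Ω N m) ⟩
      Ω N m                       ∎
      where open ≡-Reasoning

    Ω-double-shift : ∀ m → Ω N (m + 2 * τ) ≡ Ω N m
    Ω-double-shift m = begin
      Ω N (m + 2 * τ)                           ≡⟨ cong (Ω N) (regroup m τ) ⟩
      Ω N (m + τ + τ)                           ≡⟨ Ω-shift (m + τ) ⟩
      negOnePow τ *ℤ Ω N (m + τ)                ≡⟨ cong (negOnePow τ *ℤ_) (Ω-shift m) ⟩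
      negOnePow τ *ℤ (negOnePow τ *ℤ Ω N m)     ≡⟨ negOnePow-involutive τ (Ω N m) ⟩
      Ω N m                                     ∎
      where
      open ≡-Reasoning
      regroup : ∀ m τ → m + 2 * τ ≡ m + τ + τ
      regroup = solve-∀

    Ω-complement : ∀ m j → m + suc j ≡ τ → Ω N j ≡ negOnePow (τ + 1) *ℤ Ω N m
    Ω-complement m j m+1+j≡τ = begin
      Ω N j
        ≡⟨ Ω-formula j ⟩
      negOnePow j *ℤ + P[ suc j ]
        ≡⟨ cong (λ s → negOnePow j *ℤ + proj₁ s) (reverse-PQ m j m+1+j≡τ) ⟨
      negOnePow j *ℤ + P[ suc m ]
        ≡⟨ cong (_*ℤ + P[ suc m ]) (negOnePow-complement m+1+j≡τ) ⟩
      negOnePow (τ + 1) *ℤ negOnePow m *ℤ + P[ suc m ]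
        ≡⟨ ℤ.*-assoc (negOnePow (τ + 1)) (negOnePow m) (+ P[ suc m ]) ⟩
      negOnePow (τ + 1) *ℤ (negOnePow m *ℤ + P[ suc m ])
        ≡⟨ cong (negOnePow (τ + 1) *ℤ_) (Ω-formula m) ⟨
      negOnePow (τ + 1) *ℤ Ω N m
        ∎
      where open ≡-Reasoning

theorem2 : (N : ℕ) → 1 ≤ N → ¬ (∃ λ k → k * k ≡ N) →
    (τ : ℕ) → IsMinimalPeriod N τ →
    ((τ % 2 ≡ 0 → ∀ m → 1 ≤ m → Ω N (m + τ) ≡ Ω N m)
    × (τ % 2 ≡ 1 → ∀ m → 1 ≤ m → Ω N (m + 2 * τ) ≡ Ω N m)
    × (∀ m → 1 ≤ m → m ≤ τ ∸ 2 → Ω N (τ ∸ m ∸ 1) ≡ negOnePow (τ + 1) *ℤ Ω N m))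
theorem2 N _ nonsquare τ τ-minimal =
    (λ even m _ → Ω-even-shift even m)
  , (λ _ m _ → Ω-double-shift m)
  , (λ m 1≤m m≤τ∸2 →
       Ω-complement m (τ ∸ m ∸ 1) (m+suc[n∸m∸1]≡n (<-of-≤∸2 1≤m m≤τ∸2)))
  where
  a₀²<N : a₀ N * a₀ N < N
  a₀²<N = ≤∧≢⇒< (a₀-sq≤ N) (λ square → nonsquare (a₀ N , square))

  open CompleteQuotients N a₀²<N
  open Period τ τ-minimal
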